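{- Let $m\le n$ and let $S=\{\mathbf{u}_1,\dots,\mathbf{u}_m\}\subseteq\mathbb{F}_2^n$ be a permutative set of $m$ distinct vectors. Then the disjunctive closure \[\langle S\rangle_\vee:=\{a_1\mathbf{u}_1\vee a_2\mathbf{u}_2\vee\cdots\vee a_m\mathbf{u}_m\mid a_i\in\mathbb{F}_2,\ 1\le i\le m\}\] is a powerful set of size $2^m$.
   Context: A set $S\subseteq\mathbb{F}_2^n$ is a powerful set if for every $X\subseteq[n]$ the number of vectors in $S$ that are zero in all positions of $X$ is a power of $2$. For $\mathbf{u}=(u_i),\mathbf{v}=(v_i)\in\mathbb{F}_2^n$, $\mathbf{u}\vee\mathbf{v}:=(\max\{u_i,v_i\})_{i=1}^n$; for $a\in\mathbb{F}_2$, $a\mathbf{u}=\mathbf{u}$ if $a=1$ and $a\mathbf{u}=\mathbf{0}$ if $a=0$. A set $S\subseteq\mathbb{F}_2^n$ is permutative if the $|S|\times n$ matrix whose rows are the elements of $S$ contains a $|S|\times|S|$ submatrix (obtained by choosing $|S|$ columns) that is a permutation matrix, i.e. has exactly one entry $1$ in each row and each column and $0$s elsewhere. -}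

module Defs where

open import Data.Bool using (Bool; true; false; _∧_; _∨_; not; if_then_else_)
open import Data.Nat using (ℕ; zero; suc; _+_; _^_)
open import Data.Fin using (Fin; zero; suc)
open import Data.Fin.Subset using (Subset; inside; outside; _∈_)
open import Data.Vec using (Vec; []; _∷_; lookup; replicate; zipWith; map; _++_; concat)
open import Data.List as List using (List; []; _∷_; filter; length)
import Data.List as L
open import Data.Bool.ListAction using (any; all)
open import Data.Product using (Σ; ∃; _×_; _,_)
open import Relation.Binary.PropositionalEquality using (_≡_)
open import Relation.Nullary using (Dec; yes; no; ¬_)
open import Relation.Nullary.Decidable using (⌊_⌋)
open import Data.Fin.Properties using () renaming (_≟_ to _≟ᶠ_)
open import Function.Definitions using (Injective)

-- F_2^n is modelled as Vec Bool n (false = 0, true = 1).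

_∨ᵛ_ : ∀ {n} → Vec Bool n → Vec Bool n → Vec Bool n
_∨ᵛ_ = zipWith _∨_

_·ᵛ_ : ∀ {n} → Bool → Vec Bool n → Vec Bool n
a ·ᵛ u = if a then u else replicate _ false

𝟎 : ∀ {n} → Vec Bool n
𝟎 = replicate _ false

disj : ∀ {m n} → Vec Bool m → (Fin m → Vec Bool n) → Vec Bool n
disj [] u = 𝟎
disj (a ∷ as) u = (a ·ᵛ u zero) ∨ᵛ disj as (λ i → u (suc i))

allVecs : (n : ℕ) → List (Vec Bool n)
allVecs zero = [] ∷ []
allVecs (suc n) = L.map (false ∷_) (allVecs n) L.++ L.map (true ∷_) (allVecs n)

_==_ : ∀ {n} → Vec Bool n → Vec Bool n → Bool
[] == [] = true
(false ∷ x) == (false ∷ y) = x == y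
(true ∷ x) == (true ∷ y) = x == y
(_ ∷ _) == (_ ∷ _) = false

-- A finite subset of F_2^n, given by its (decidable) characteristic function.
FSet : ℕ → Set
FSet n = Vec Bool n → Bool

card : ∀ {n} → FSet n → ℕ
card {n} S = length (filter (λ v → S v Data.Bool.≟ true) (allVecs n))
  where import Data.Bool

disjClosure : ∀ {m n} → (Fin m → Vec Bool n) → FSet n
disjClosure {m} u v = any (λ a → disj a u == v) (allVecs m)

zeroOn : ∀ {n} → Subset n → Vec Bool n → Bool
zeroOn X v = all (λ i → not (lookup X i ∧ lookup v i)) (L.allFin _)

Powerful : ∀ {n} → FSet n → Set
Powerful {n} S = (X : Subset n) → ∃ λ k → card (λ v → S v ∧ zeroOn X v) ≡ 2 ^ k

IsPermutationMatrix : ∀ {m} → (Fin m → Fin m → Bool) → Set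
IsPermutationMatrix {m} M =
  (∀ i → Σ (Fin m) λ j → M i j ≡ true × (∀ j' → M i j' ≡ true → j' ≡ j)) ×
  (∀ j → Σ (Fin m) λ i → M i j ≡ true × (∀ i' → M i' j ≡ true → i' ≡ i))

Permutative : ∀ {m n} → (Fin m → Vec Bool n) → Set
Permutative {m} {n} u = Σ (Fin m → Fin n) λ c →
  Injective _≡_ _≡_ c × IsPermutationMatrix (λ i j → lookup (u i) (c j))

-- The permutation submatrix gives every uᵢ a private column: a coordinate
-- where uᵢ is 1 and all other uⱼ are 0. That coordinate of a₁u₁ ∨ ⋯ ∨ aₘuₘ
-- equals aᵢ, so a ↦ a₁u₁ ∨ ⋯ ∨ aₘuₘ is injective and ⟨S⟩_∨ has 2^m elements.
-- A join is zero on X exactly when every uᵢ with aᵢ = 1 is zero on X, so the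
-- elements of ⟨S⟩_∨ that are zero on X correspond to the subsets of
-- T = {i | uᵢ is zero on X}; there are 2^|T| of them.
module Submission where

open import Defs
open import Data.Bool using (Bool; true; false; _∧_; _∨_; not; _≟_)
open import Data.Bool.ListAction using (any; all)
open import Data.Bool.Properties using (∧-zeroʳ; ∧-identityʳ; ∨-identityʳ; ∧-distribʳ-∨; ¬-not)
open import Data.Empty using (⊥-elim)
open import Data.Fin using (Fin; zero; suc)
open import Data.Fin.Properties using (0≢1+n; suc-injective)
open import Data.Fin.Subset using (Subset; inside; outside; ∣_∣)
open import Data.List as List using (List; []; _∷_; _++_; length; filter)
open import Data.List.Membership.Propositional using (_∈_)
open import Data.List.Membership.Propositional.Properties using (∈-map⁻)
open import Data.List.Properties using (length-++; length-map)
open import Data.List.Relation.Unary.All as All using (All; []; _∷_)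
open import Data.List.Relation.Unary.Unique.Propositional using (Unique; []; _∷_)
import Data.List.Relation.Unary.Unique.Propositional.Properties as Unique
open import Data.Nat using (ℕ; zero; suc; _≤_; _+_; _^_)
open import Data.Nat.Properties using (+-identityʳ; +-assoc; +-commutativeSemigroup)
open import Algebra.Properties.CommutativeSemigroup +-commutativeSemigroup using (interchange)
open import Data.Product using (∃; _×_; _,_)
open import Data.Vec using (Vec; []; _∷_; lookup; tabulate)
open import Data.Vec.Properties using (lookup-zipWith; lookup-replicate; tabulate∘lookup; tabulate-cong; ∷-injectiveʳ)
open import Function using (_∘_)
open import Function.Definitions using (Injective)
open import Relation.Binary.PropositionalEquality
open import Relation.Nullary using (¬_)

open ≡-Reasoning

𝟙 : Bool → ℕ
𝟙 true  = 1
𝟙 false = 0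

count : ∀ {A : Set} → (A → Bool) → List A → ℕ
count p []       = 0
count p (x ∷ xs) = 𝟙 (p x) + count p xs

card≡count : ∀ {n} (S : FSet n) → card S ≡ count S (allVecs n)
card≡count {n} S = go (allVecs n)
  where
  go : ∀ xs → length (filter (λ v → S v ≟ true) xs) ≡ count S xs
  go []       = refl
  go (x ∷ xs) with S x
  ... | true  = cong suc (go xs)
  ... | false = go xs

count-cong : ∀ {A : Set} {p q : A → Bool} → (∀ x → p x ≡ q x) → ∀ xs → count p xs ≡ count q xs
count-cong p≗q []       = refl
count-cong p≗q (x ∷ xs) = cong₂ _+_ (cong 𝟙 (p≗q x)) (count-cong p≗q xs)

card-cong : ∀ {n} {S S′ : FSet n} → (∀ v → S v ≡ S′ v) → card S ≡ card S′
card-cong {n} {S} {S′} S≗S′ = begin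
  card S                ≡⟨ card≡count S ⟩
  count S (allVecs n)   ≡⟨ count-cong S≗S′ (allVecs n) ⟩
  count S′ (allVecs n)  ≡⟨ card≡count S′ ⟨
  card S′               ∎

count-++ : ∀ {A : Set} (p : A → Bool) xs ys → count p (xs ++ ys) ≡ count p xs + count p ys
count-++ p []       ys = refl
count-++ p (x ∷ xs) ys = trans (cong (𝟙 (p x) +_) (count-++ p xs ys)) (sym (+-assoc (𝟙 (p x)) _ _))

count-map : ∀ {A B : Set} (p : B → Bool) (f : A → B) xs → count p (List.map f xs) ≡ count (p ∘ f) xs
count-map p f []       = refl
count-map p f (x ∷ xs) = cong (𝟙 (p (f x)) +_) (count-map p f xs)

count-false : ∀ {A : Set} (xs : List A) → count (λ _ → false) xs ≡ 0
count-false []       = refl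
count-false (x ∷ xs) = count-false xs

count-true : ∀ {A : Set} (xs : List A) → count (λ _ → true) xs ≡ length xs
count-true []       = refl
count-true (x ∷ xs) = cong suc (count-true xs)

count-∨-disjoint : ∀ {A : Set} {p q : A → Bool} → (∀ x → p x ≡ true → q x ≡ false) →
  ∀ xs → count (λ x → p x ∨ q x) xs ≡ count p xs + count q xs
count-∨-disjoint             disjoint []       = refl
count-∨-disjoint {p = p} {q} disjoint (x ∷ xs) = begin
  𝟙 (p x ∨ q x) + count (λ x → p x ∨ q x) xs
    ≡⟨ cong₂ _+_ 𝟙-∨ (count-∨-disjoint disjoint xs) ⟩
  (𝟙 (p x) + 𝟙 (q x)) + (count p xs + count q xs)
    ≡⟨ interchange (𝟙 (p x)) _ _ _ ⟩
  (𝟙 (p x) + count p xs) + (𝟙 (q x) + count q xs) ∎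
  where
  𝟙-∨ : 𝟙 (p x ∨ q x) ≡ 𝟙 (p x) + 𝟙 (q x)
  𝟙-∨ with p x in px
  ... | false = refl
  ... | true rewrite disjoint x px = refl

count-allVecs-suc : ∀ {n} (p : Vec Bool (suc n) → Bool) →
  count p (allVecs (suc n)) ≡ count (p ∘ (false ∷_)) (allVecs n) + count (p ∘ (true ∷_)) (allVecs n)
count-allVecs-suc {n} p = begin
  count p (List.map (false ∷_) (allVecs n) ++ List.map (true ∷_) (allVecs n))
    ≡⟨ count-++ p (List.map (false ∷_) (allVecs n)) _ ⟩
  count p (List.map (false ∷_) (allVecs n)) + count p (List.map (true ∷_) (allVecs n))
    ≡⟨ cong₂ _+_ (count-map p _ (allVecs n)) (count-map p _ (allVecs n)) ⟩
  count (p ∘ (false ∷_)) (allVecs n) + count (p ∘ (true ∷_)) (allVecs n) ∎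

length-allVecs : ∀ n → length (allVecs n) ≡ 2 ^ n
length-allVecs zero    = refl
length-allVecs (suc n) = begin
  length (List.map (false ∷_) (allVecs n) ++ List.map (true ∷_) (allVecs n))
    ≡⟨ length-++ (List.map (false ∷_) (allVecs n)) ⟩
  length (List.map (false ∷_) (allVecs n)) + length (List.map (true ∷_) (allVecs n))
    ≡⟨ cong₂ _+_ (length-map _ (allVecs n)) (length-map _ (allVecs n)) ⟩
  length (allVecs n) + length (allVecs n)
    ≡⟨ cong₂ _+_ (length-allVecs n) (trans (length-allVecs n) (sym (+-identityʳ (2 ^ n)))) ⟩
  2 ^ suc n ∎

allVecs-unique : ∀ n → Unique (allVecs n)
allVecs-unique zero    = [] ∷ []
allVecs-unique (suc n) =
  Unique.++⁺ (Unique.map⁺ ∷-injectiveʳ (allVecs-unique n))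
             (Unique.map⁺ ∷-injectiveʳ (allVecs-unique n))
             heads-differ
  where
  heads-differ : ∀ {v} → ¬ (v ∈ List.map (false ∷_) (allVecs n) × v ∈ List.map (true ∷_) (allVecs n))
  heads-differ (v∈false , v∈true) with ∈-map⁻ (false ∷_) v∈false | ∈-map⁻ (true ∷_) v∈true
  ... | _ , _ , refl | _ , _ , ()

==⇒≡ : ∀ {n} {v w : Vec Bool n} → (v == w) ≡ true → v ≡ w
==⇒≡ {v = []}        {[]}        _  = refl
==⇒≡ {v = false ∷ v} {false ∷ w} eq = cong (false ∷_) (==⇒≡ eq)
==⇒≡ {v = true ∷ v}  {true ∷ w}  eq = cong (true ∷_) (==⇒≡ eq)
==⇒≡ {v = false ∷ v} {true ∷ w}  ()
==⇒≡ {v = true ∷ v}  {false ∷ w} ()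

count-allVecs-== : ∀ n (w : Vec Bool n) (Q : Vec Bool n → Bool) →
  count (λ v → (w == v) ∧ Q v) (allVecs n) ≡ 𝟙 (Q w)
count-allVecs-== zero    []      Q = +-identityʳ _
count-allVecs-== (suc n) (b ∷ w) Q =
  trans (count-allVecs-suc (λ v → ((b ∷ w) == v) ∧ Q v)) (halves b)
  where
  halves : ∀ b → count (λ v → ((b ∷ w) == (false ∷ v)) ∧ Q (false ∷ v)) (allVecs n)
               + count (λ v → ((b ∷ w) == (true ∷ v)) ∧ Q (true ∷ v)) (allVecs n) ≡ 𝟙 (Q (b ∷ w))
  halves false = trans (cong₂ _+_ (count-allVecs-== n w (Q ∘ (false ∷_))) (count-false (allVecs n)))
                       (+-identityʳ _)
  halves true  = trans (cong (_+ count (λ v → (w == v) ∧ Q (true ∷ v)) (allVecs n)) (count-false (allVecs n)))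
                       (count-allVecs-== n w (Q ∘ (true ∷_)))

any-==-false : ∀ {A : Set} {n} (D : A → Vec Bool n) {w} {as} →
  All (λ a → D a ≢ w) as → any (λ a → D a == w) as ≡ false
any-==-false D []                = refl
any-==-false D {w} {a ∷ _} (Da≢w ∷ rest) with D a == w in eq
... | true  = ⊥-elim (Da≢w (==⇒≡ eq))
... | false = any-==-false D rest

count-image : ∀ {A : Set} {n} (D : A → Vec Bool n) → Injective _≡_ _≡_ D →
  ∀ {as} → Unique as → (Q : Vec Bool n → Bool) →
  count (λ v → any (λ a → D a == v) as ∧ Q v) (allVecs n) ≡ count (Q ∘ D) as
count-image {n = n} D D-inj []                 Q = count-false (allVecs n)
count-image {n = n} D D-inj {a ∷ as} (a∉as ∷ as-unique) Q = begin
  count (λ v → ((D a == v) ∨ rest v) ∧ Q v) (allVecs n)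
    ≡⟨ count-cong (λ v → ∧-distribʳ-∨ (Q v) (D a == v) (rest v)) (allVecs n) ⟩
  count (λ v → ((D a == v) ∧ Q v) ∨ (rest v ∧ Q v)) (allVecs n)
    ≡⟨ count-∨-disjoint disjoint (allVecs n) ⟩
  count (λ v → (D a == v) ∧ Q v) (allVecs n) + count (λ v → rest v ∧ Q v) (allVecs n)
    ≡⟨ cong₂ _+_ (count-allVecs-== n (D a) Q) (count-image D D-inj as-unique Q) ⟩
  𝟙 (Q (D a)) + count (Q ∘ D) as ∎
  where
  rest : Vec Bool n → Bool
  rest v = any (λ b → D b == v) as
  disjoint : ∀ v → (D a == v) ∧ Q v ≡ true → rest v ∧ Q v ≡ false
  disjoint v hit with D a == v in eq
  disjoint v () | false
  disjoint v _  | true =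
    cong (_∧ Q v) (any-==-false D (All.map (λ a≢b Db≡v → a≢b (D-inj (trans (==⇒≡ eq) (sym Db≡v)))) a∉as))

lookup-·ᵛ : ∀ {n} a (v : Vec Bool n) k → lookup (a ·ᵛ v) k ≡ a ∧ lookup v k
lookup-·ᵛ true  v k = refl
lookup-·ᵛ false v k = lookup-replicate k false

lookup-disj-∷ : ∀ {m n} a (as : Vec Bool m) (u : Fin (suc m) → Vec Bool n) k →
  lookup (disj (a ∷ as) u) k ≡ (a ∧ lookup (u zero) k) ∨ lookup (disj as (u ∘ suc)) k
lookup-disj-∷ a as u k =
  trans (lookup-zipWith _∨_ k (a ·ᵛ u zero) (disj as (u ∘ suc)))
        (cong (_∨ lookup (disj as (u ∘ suc)) k) (lookup-·ᵛ a (u zero) k))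

lookup-disj-≡false : ∀ {m n} (a : Vec Bool m) (u : Fin m → Vec Bool n) k →
  (∀ i → lookup (u i) k ≡ false) → lookup (disj a u) k ≡ false
lookup-disj-≡false []       u k _       = lookup-replicate k false
lookup-disj-≡false (a ∷ as) u k column0 = begin
  lookup (disj (a ∷ as) u) k
    ≡⟨ lookup-disj-∷ a as u k ⟩
  (a ∧ lookup (u zero) k) ∨ lookup (disj as (u ∘ suc)) k
    ≡⟨ cong₂ (λ x y → (a ∧ x) ∨ y) (column0 zero) (lookup-disj-≡false as (u ∘ suc) k (column0 ∘ suc)) ⟩
  (a ∧ false) ∨ false
    ≡⟨ cong (_∨ false) (∧-zeroʳ a) ⟩
  false ∎

PrivateColumn : ∀ {m n} → (Fin m → Vec Bool n) → Fin m → Fin n → Set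
PrivateColumn u i k = lookup (u i) k ≡ true × (∀ i′ → lookup (u i′) k ≡ true → i′ ≡ i)

lookup-disj-private : ∀ {m n} (a : Vec Bool m) (u : Fin m → Vec Bool n) {i k} →
  PrivateColumn u i k → lookup (disj a u) k ≡ lookup a i
lookup-disj-private (a ∷ as) u {zero} {k} (hit , only) = begin
  lookup (disj (a ∷ as) u) k
    ≡⟨ lookup-disj-∷ a as u k ⟩
  (a ∧ lookup (u zero) k) ∨ lookup (disj as (u ∘ suc)) k
    ≡⟨ cong₂ (λ x y → (a ∧ x) ∨ y) hit
             (lookup-disj-≡false as (u ∘ suc) k (λ i → ¬-not (0≢1+n ∘ sym ∘ only (suc i)))) ⟩
  (a ∧ true) ∨ false
    ≡⟨ trans (∨-identityʳ _) (∧-identityʳ a) ⟩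
  a ∎
lookup-disj-private (a ∷ as) u {suc i} {k} (hit , only) = begin
  lookup (disj (a ∷ as) u) k
    ≡⟨ lookup-disj-∷ a as u k ⟩
  (a ∧ lookup (u zero) k) ∨ lookup (disj as (u ∘ suc)) k
    ≡⟨ cong₂ (λ x y → (a ∧ x) ∨ y) (¬-not (0≢1+n ∘ only zero))
             (lookup-disj-private as (u ∘ suc) (hit , λ i′ h → suc-injective (only (suc i′) h))) ⟩
  (a ∧ false) ∨ lookup as i
    ≡⟨ cong (_∨ lookup as i) (∧-zeroʳ a) ⟩
  lookup as i ∎

permutative⇒privateColumn : ∀ {m n} {u : Fin m → Vec Bool n} →
  Permutative u → ∀ i → ∃ (PrivateColumn u i)
permutative⇒privateColumn {u = u} (c , _ , rows , columns) i with rows i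
... | j , hit , _ with columns j
... | _ , _ , only = c j , hit , λ i′ h → trans (only i′ h) (sym (only i hit))

disj-injective : ∀ {m n} {u : Fin m → Vec Bool n} → Permutative u → Injective _≡_ _≡_ (λ a → disj a u)
disj-injective {u = u} perm {a} {b} eq = begin
  a                    ≡⟨ tabulate∘lookup a ⟨
  tabulate (lookup a)  ≡⟨ tabulate-cong same-entries ⟩
  tabulate (lookup b)  ≡⟨ tabulate∘lookup b ⟩
  b                    ∎
  where
  same-entries : ∀ i → lookup a i ≡ lookup b i
  same-entries i with permutative⇒privateColumn {u = u} perm i
  ... | k , column = begin
    lookup a i             ≡⟨ lookup-disj-private a u column ⟨
    lookup (disj a u) k    ≡⟨ cong (λ v → lookup v k) eq ⟩
    lookup (disj b u) k    ≡⟨ lookup-disj-private b u column ⟩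
    lookup b i             ∎

all-cong : ∀ {A : Set} {p q : A → Bool} → (∀ x → p x ≡ q x) → ∀ xs → all p xs ≡ all q xs
all-cong p≗q []       = refl
all-cong p≗q (x ∷ xs) = cong₂ _∧_ (p≗q x) (all-cong p≗q xs)

all-∧ : ∀ {A : Set} (p q : A → Bool) xs → all (λ x → p x ∧ q x) xs ≡ all p xs ∧ all q xs
all-∧ p q []       = refl
all-∧ p q (x ∷ xs) with p x | q x
... | true  | true  = all-∧ p q xs
... | true  | false = sym (∧-zeroʳ (all p xs))
... | false | _     = refl

all-true : ∀ {A : Set} (xs : List A) → all (λ _ → true) xs ≡ true
all-true []       = refl
all-true (x ∷ xs) = all-true xs

zeroOn-𝟎 : ∀ {n} (X : Subset n) → zeroOn X 𝟎 ≡ true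
zeroOn-𝟎 {n} X = trans (all-cong entry (List.allFin n)) (all-true (List.allFin n))
  where
  entry : ∀ i → not (lookup X i ∧ lookup 𝟎 i) ≡ true
  entry i = cong not (trans (cong (lookup X i ∧_) (lookup-replicate i false)) (∧-zeroʳ (lookup X i)))

zeroOn-∨ᵛ : ∀ {n} (X : Subset n) v w → zeroOn X (v ∨ᵛ w) ≡ zeroOn X v ∧ zeroOn X w
zeroOn-∨ᵛ {n} X v w =
  trans (all-cong entry (List.allFin n))
        (all-∧ (λ i → not (lookup X i ∧ lookup v i)) (λ i → not (lookup X i ∧ lookup w i)) (List.allFin n))
  where
  entry : ∀ i → not (lookup X i ∧ lookup (v ∨ᵛ w) i) ≡ not (lookup X i ∧ lookup v i) ∧ not (lookup X i ∧ lookup w i)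
  entry i rewrite lookup-zipWith _∨_ i v w with lookup X i | lookup v i
  ... | false | _     = refl
  ... | true  | true  = refl
  ... | true  | false = refl

zeroOn-·ᵛ : ∀ {n} (X : Subset n) a v → zeroOn X (a ·ᵛ v) ≡ not a ∨ zeroOn X v
zeroOn-·ᵛ X true  v = refl
zeroOn-·ᵛ X false v = zeroOn-𝟎 X

_⊆ᵇ_ : ∀ {m} → Vec Bool m → Subset m → Bool
[]       ⊆ᵇ []       = true
(a ∷ as) ⊆ᵇ (t ∷ ts) = (not a ∨ t) ∧ (as ⊆ᵇ ts)

zeroOn-disj : ∀ {m n} (X : Subset n) (a : Vec Bool m) (u : Fin m → Vec Bool n) →
  zeroOn X (disj a u) ≡ a ⊆ᵇ tabulate (zeroOn X ∘ u)
zeroOn-disj X []       u = zeroOn-𝟎 X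
zeroOn-disj X (a ∷ as) u =
  trans (zeroOn-∨ᵛ X (a ·ᵛ u zero) (disj as (u ∘ suc)))
        (cong₂ _∧_ (zeroOn-·ᵛ X a (u zero)) (zeroOn-disj X as (u ∘ suc)))

count-⊆ᵇ : ∀ {m} (T : Subset m) → count (_⊆ᵇ T) (allVecs m) ≡ 2 ^ ∣ T ∣
count-⊆ᵇ {zero}  []            = refl
count-⊆ᵇ {suc m} (outside ∷ T) = trans (count-allVecs-suc (_⊆ᵇ (outside ∷ T)))
  (trans (cong₂ _+_ (count-⊆ᵇ T) (count-false (allVecs m))) (+-identityʳ _))
count-⊆ᵇ {suc m} (inside ∷ T)  = trans (count-allVecs-suc (_⊆ᵇ (inside ∷ T)))
  (cong₂ _+_ (count-⊆ᵇ T) (trans (count-⊆ᵇ T) (sym (+-identityʳ (2 ^ ∣ T ∣)))))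

card-disjClosure-∧ : ∀ {m n} {u : Fin m → Vec Bool n} → Permutative u → (Q : Vec Bool n → Bool) →
  card (λ v → disjClosure u v ∧ Q v) ≡ count (λ a → Q (disj a u)) (allVecs m)
card-disjClosure-∧ {m} {u = u} perm Q =
  trans (card≡count (λ v → disjClosure u v ∧ Q v))
        (count-image (λ a → disj a u) (disj-injective perm) (allVecs-unique m) Q)

-- The hypotheses m ≤ n and injectivity of u are consequences of permutativity.
theorem8 : (m n : ℕ) → m ≤ n → (u : Fin m → Vec Bool n) →
    Injective _≡_ _≡_ u → Permutative u →
    Powerful (disjClosure u) × card (disjClosure u) ≡ 2 ^ m
theorem8 m n _ u _ perm = powerful , size
  where
  powerful : Powerful (disjClosure u)
  powerful X = ∣ T ∣ , (begin
    card (λ v → disjClosure u v ∧ zeroOn X v)         ≡⟨ card-disjClosure-∧ perm (zeroOn X) ⟩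
    count (λ a → zeroOn X (disj a u)) (allVecs m)     ≡⟨ count-cong (λ a → zeroOn-disj X a u) (allVecs m) ⟩
    count (_⊆ᵇ T) (allVecs m)                         ≡⟨ count-⊆ᵇ T ⟩
    2 ^ ∣ T ∣                                         ∎)
    where
    T : Subset m
    T = tabulate (zeroOn X ∘ u)
  size : card (disjClosure u) ≡ 2 ^ m
  size = begin
    card (disjClosure u)                              ≡⟨ card-cong (λ v → ∧-identityʳ (disjClosure u v)) ⟨
    card (λ v → disjClosure u v ∧ true)               ≡⟨ card-disjClosure-∧ perm (λ _ → true) ⟩
    count (λ _ → true) (allVecs m)                    ≡⟨ count-true (allVecs m) ⟩
    length (allVecs m)                                ≡⟨ length-allVecs m ⟩
    2 ^ m                                             ∎
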